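{- For all non-negative integers $n$ and $t$, the integer $\binom{3n}{n+t}\binom{2n+t}{2n}$ is divisible by $2n+1$.
   Context: Binomial coefficients $\binom{a}{b}$ with $b>a\ge 0$ are taken to be $0$. -}

module Defs where

{-# OPTIONS --safe #-}
module Submission where

open import Defs
open import Data.Nat using (ℕ; suc; _+_; _*_)
open import Data.Nat.Divisibility using (_∣_)
open import Data.Nat.Combinatorics using (_C_)

open import Data.Nat using (zero; s≤s; z≤n)
open import Data.Nat.Properties
  using (+-comm; +-suc; +-identityʳ; +-cancelˡ-≡; +-cancelʳ-≡; *-zeroʳ; *-identityʳ; *-distribˡ-+; *-distribʳ-+)
open import Data.Nat.Divisibility using (m∣m*n; ∣m+n∣m⇒∣n; ∣n⇒∣m*n; ∣1⇒≡1)
open import Data.Nat.Combinatorics using (nCk+nC[k+1]≡[n+1]C[k+1]; k>n⇒nCk≡0; nC1≡n)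
open import Data.Nat.Coprimality using (Coprime; coprime-divisor)
open import Data.Nat.Tactic.RingSolver using (solve-∀)
open import Data.Product using (_,_)
open import Relation.Binary.PropositionalEquality
  using (_≡_; refl; sym; trans; cong; cong₂; subst; module ≡-Reasoning)

open ≡-Reasoning

-- With c = N C k, c′ = (N+1) C k, d = (j+t) C j and e = (j+t) C (j+1), the
-- absorption identities  k c′ + (N+1) c = (N+1) c′  and  t d = (j+1) e  combine,
-- whenever k + j = N + t, into  (j+1) c′ e + (N+1) c d = (j+1) c′ d.  Hence j+1
-- divides (N+1) c d.  For N = 3n, k = n+t, j = 2n the factor N+1 = 3n+1 is
-- coprime to 2n+1, because 3(2n+1) = 2(3n+1) + 1.

[k+1]*[n+1]C[k+1]≡[n+1]*nCk : ∀ n k → suc k * (suc n C suc k) ≡ suc n * (n C k)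
[k+1]*[n+1]C[k+1]≡[n+1]*nCk zero    zero    = refl
[k+1]*[n+1]C[k+1]≡[n+1]*nCk zero    (suc k) =
  trans (cong (suc (suc k) *_) (k>n⇒nCk≡0 {1} {suc (suc k)} (s≤s (s≤s z≤n)))) (*-zeroʳ (suc (suc k)))
[k+1]*[n+1]C[k+1]≡[n+1]*nCk (suc n) zero    =
  trans (+-identityʳ _) (trans (nC1≡n (suc (suc n))) (sym (*-identityʳ _)))
[k+1]*[n+1]C[k+1]≡[n+1]*nCk (suc n) (suc k) = begin
  suc (suc k) * (suc (suc n) C suc (suc k))
    ≡⟨ cong (suc (suc k) *_) (nCk+nC[k+1]≡[n+1]C[k+1] (suc n) (suc k)) ⟨
  suc (suc k) * (suc n C suc k + suc n C suc (suc k))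
    ≡⟨ split (suc k) (suc n C suc k) (suc n C suc (suc k)) ⟩
  suc k * (suc n C suc k) + suc n C suc k + suc (suc k) * (suc n C suc (suc k))
    ≡⟨ cong₂ (λ x y → x + suc n C suc k + y)
         ([k+1]*[n+1]C[k+1]≡[n+1]*nCk n k) ([k+1]*[n+1]C[k+1]≡[n+1]*nCk n (suc k)) ⟩
  suc n * (n C k) + suc n C suc k + suc n * (n C suc k)
    ≡⟨ regroup (suc n) (n C k) (n C suc k) (suc n C suc k) ⟩
  suc n * (n C k + n C suc k) + suc n C suc k
    ≡⟨ cong (λ x → suc n * x + suc n C suc k) (nCk+nC[k+1]≡[n+1]C[k+1] n k) ⟩
  suc n * (suc n C suc k) + suc n C suc k
    ≡⟨ +-comm (suc n * (suc n C suc k)) _ ⟩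
  suc (suc n) * (suc n C suc k) ∎
  where
  split : ∀ m a b → suc m * (a + b) ≡ m * a + a + suc m * b
  split = solve-∀
  regroup : ∀ m a b c → m * a + c + m * b ≡ m * (a + b) + c
  regroup = solve-∀

k*[n+1]Ck+[n+1]*nCk≡[n+1]*[n+1]Ck : ∀ n k → k * (suc n C k) + suc n * (n C k) ≡ suc n * (suc n C k)
k*[n+1]Ck+[n+1]*nCk≡[n+1]*[n+1]Ck n zero    = refl
k*[n+1]Ck+[n+1]*nCk≡[n+1]*[n+1]Ck n (suc k) = begin
  suc k * (suc n C suc k) + suc n * (n C suc k)
    ≡⟨ cong (_+ suc n * (n C suc k)) ([k+1]*[n+1]C[k+1]≡[n+1]*nCk n k) ⟩
  suc n * (n C k) + suc n * (n C suc k)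
    ≡⟨ *-distribˡ-+ (suc n) (n C k) (n C suc k) ⟨
  suc n * (n C k + n C suc k)
    ≡⟨ cong (suc n *_) (nCk+nC[k+1]≡[n+1]C[k+1] n k) ⟩
  suc n * (suc n C suc k) ∎

t*[k+t]Ck≡[k+1]*[k+t]C[k+1] : ∀ k t → t * ((k + t) C k) ≡ suc k * ((k + t) C suc k)
t*[k+t]Ck≡[k+1]*[k+t]C[k+1] k t = +-cancelˡ-≡ (suc k * x) _ _ (begin
  suc k * x + t * x              ≡⟨ *-distribʳ-+ x (suc k) t ⟨
  (suc k + t) * x                ≡⟨ [k+1]*[n+1]C[k+1]≡[n+1]*nCk (k + t) k ⟨
  suc k * (suc (k + t) C suc k)  ≡⟨ cong (suc k *_) (nCk+nC[k+1]≡[n+1]C[k+1] (k + t) k) ⟨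
  suc k * (x + y)                ≡⟨ *-distribˡ-+ (suc k) x y ⟩
  suc k * x + suc k * y          ∎)
  where
  x = (k + t) C k
  y = (k + t) C suc k

[j+1]∣[N+1]*NCk*[j+t]Cj : ∀ N k j t → k + j ≡ N + t → suc j ∣ suc N * ((N C k) * ((j + t) C j))
[j+1]∣[N+1]*NCk*[j+t]Cj N k j t k+j≡N+t =
  ∣m+n∣m⇒∣n (subst (suc j ∣_) (sym identity) (m∣m*n (c′ * d))) (m∣m*n (c′ * e))
  where
  c  = N C k
  c′ = suc N C k
  d  = (j + t) C j
  e  = (j + t) C suc j
  k+[j+1]≡[N+1]+t : k + suc j ≡ suc N + t
  k+[j+1]≡[N+1]+t = trans (+-suc k j) (cong suc k+j≡N+t)
  identity : suc j * (c′ * e) + suc N * (c * d) ≡ suc j * (c′ * d)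
  identity = +-cancelʳ-≡ (k * (c′ * d)) _ _ (begin
    suc j * (c′ * e) + suc N * (c * d) + k * (c′ * d)
      ≡⟨ regroup (suc j) (suc N) k c c′ d e ⟩
    (k * c′ + suc N * c) * d + c′ * (suc j * e)
      ≡⟨ cong₂ (λ x y → x * d + c′ * y)
           (k*[n+1]Ck+[n+1]*nCk≡[n+1]*[n+1]Ck N k) (sym (t*[k+t]Ck≡[k+1]*[k+t]C[k+1] j t)) ⟩
    suc N * c′ * d + c′ * (t * d)
      ≡⟨ factor (suc N) t c′ d ⟩
    (suc N + t) * (c′ * d)
      ≡⟨ cong (_* (c′ * d)) k+[j+1]≡[N+1]+t ⟨
    (k + suc j) * (c′ * d)
      ≡⟨ *-distribʳ-+ (c′ * d) k (suc j) ⟩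
    k * (c′ * d) + suc j * (c′ * d)
      ≡⟨ +-comm (k * (c′ * d)) _ ⟩
    suc j * (c′ * d) + k * (c′ * d) ∎)
    where
    regroup : ∀ a b k c c′ d e → a * (c′ * e) + b * (c * d) + k * (c′ * d)
                                ≡ (k * c′ + b * c) * d + c′ * (a * e)
    regroup = solve-∀
    factor : ∀ a t c′ d → a * c′ * d + c′ * (t * d) ≡ (a + t) * (c′ * d)
    factor = solve-∀

[1+2n]-coprime-[1+3n] : ∀ n → Coprime (suc (2 * n)) (suc (3 * n))
[1+2n]-coprime-[1+3n] n {d} (d∣1+2n , d∣1+3n) =
  ∣1⇒≡1 (∣m+n∣m⇒∣n (subst (d ∣_) (3[1+2n]≡2[1+3n]+1 n) (∣n⇒∣m*n 3 d∣1+2n)) (∣n⇒∣m*n 2 d∣1+3n))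
  where
  3[1+2n]≡2[1+3n]+1 : ∀ n → 3 * suc (2 * n) ≡ 2 * suc (3 * n) + 1
  3[1+2n]≡2[1+3n]+1 = solve-∀

proposition4 : (n t : ℕ) → suc (2 * n) ∣ ((3 * n) C (n + t)) * ((2 * n + t) C (2 * n))
proposition4 n t = coprime-divisor ([1+2n]-coprime-[1+3n] n)
  ([j+1]∣[N+1]*NCk*[j+t]Cj (3 * n) (n + t) (2 * n) t (n+t+2n≡3n+t n t))
  where
  n+t+2n≡3n+t : ∀ n t → (n + t) + 2 * n ≡ 3 * n + t
  n+t+2n≡3n+t = solve-∀
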